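{- For $k\in\{2,3\}$, \[ \rho_3(\mathrm{BT}(k))=\frac{(k+1)(k^2+1)}{3k+2}>\rho_3\big(T_3(3k+1)\big), \] and in particular $f_3(2k+1,3)>\rho_3\big(T_3(3k+1)\big)$.
   Context: All graphs are finite and simple. For integers $\Delta,\omega$, let $\mathcal{G}(\Delta,\omega)$ be the class of graphs $G$ with maximum degree $\Delta(G)\le\Delta$ and clique number $\omega(G)\le\omega$. For a graph $G$, $k_t(G)$ denotes the number of copies of $K_t$ in $G$, and $\rho_t(G)=k_t(G)/|V(G)|$. For a positive integer $n$ let $k_t(n,\Delta,\omega)=\max\{k_t(G): |V(G)|=n,\ G\in\mathcal{G}(\Delta,\omega)\}$, and define $f_t(\Delta,\omega)=\lim_{n\to\infty}k_t(n,\Delta,\omega)/n$ (this limit exists and equals $\sup_{n}k_t(n,\Delta,\omega)/n$). $T_r(n)$ denotes the Turán graph: the complete $r$-partite graph on $n$ vertices whose part sizes differ by at most one. For $k\ge 2$, let $\widetilde{\mathrm{BT}}(k)$ be the graph obtained from $T_2(2k)=K_{k,k}$ by deleting one edge $xy$ and adding a new vertex adjacent exactly to $x$ and $y$; then $\mathrm{BT}(k)=\widetilde{\mathrm{BT}}(k)\vee I_{k+1}$ is the join of $\widetilde{\mathrm{BT}}(k)$ with an independent set of $k+1$ new vertices (each new vertex adjacent to every vertex of $\widetilde{\mathrm{BT}}(k)$). Note $\mathrm{BT}(k)$ has $3k+2$ vertices. -}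

module Defs where

open import Data.Bool using (Bool; true; false; _∧_; _∨_; not; if_then_else_)
open import Data.Bool.Properties using (∨-comm)
open import Data.Nat using (ℕ; zero; suc; _+_; _*_; _≤_; _%_; NonZero; _<ᵇ_; _≡ᵇ_)
open import Data.Fin using (Fin; toℕ; splitAt; _<?_; _≟_)
open import Data.Sum using (inj₁; inj₂)
open import Data.List using (List; allFin; concatMap; map)
open import Data.Nat.ListAction using (sum)
open import Data.Integer using (+_)
open import Data.Rational using (ℚ; _/_)
open import Function.Definitions using (Injective)
open import Relation.Nullary using (¬_; yes; no)
open import Relation.Nullary.Decidable using (⌊_⌋)
open import Relation.Binary.PropositionalEquality using (_≡_; _≢_; refl; sym)

record Graph (n : ℕ) : Set where
  field
    adj    : Fin n → Fin n → Bool
    adj-sym : ∀ u v → adj u v ≡ adj v u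
    adj-irrefl : ∀ u → adj u u ≡ false
open Graph public

mkSimple : ∀ {n} → (Fin n → Fin n → Bool) → Graph n
mkSimple {n} R = record { adj = A ; adj-sym = s ; adj-irrefl = i }
  where
  A : Fin n → Fin n → Bool
  A u v with u ≟ v
  ... | yes _ = false
  ... | no _ = R u v ∨ R v u
  s : ∀ u v → A u v ≡ A v u
  s u v with u ≟ v | v ≟ u
  ... | yes _ | yes _ = refl
  ... | yes p | no q = Data.Empty.⊥-elim (q (sym p))
    where import Data.Empty
  ... | no p | yes q = Data.Empty.⊥-elim (p (sym q))
    where import Data.Empty
  ... | no _ | no _ = ∨-comm (R u v) (R v u)
  i : ∀ u → A u u ≡ false
  i u with u ≟ u
  ... | yes _ = refl
  ... | no p = Data.Empty.⊥-elim (p refl)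
    where import Data.Empty

count : List Bool → ℕ
count bs = sum (map (λ b → if b then 1 else 0) bs)

degree : ∀ {n} → Graph n → Fin n → ℕ
degree G v = count (map (adj G v) (allFin _))

MaxDegree≤ : ∀ {n} → Graph n → ℕ → Set
MaxDegree≤ G d = ∀ v → degree G v ≤ d

IsClique : ∀ {n s} → Graph n → (Fin s → Fin n) → Set
IsClique G f = Injective _≡_ _≡_ f × (∀ i j → i ≢ j → adj G (f i) (f j) ≡ true)
  where open import Data.Product using (_×_)

CliqueNumber≤ : ∀ {n} → Graph n → ℕ → Set
CliqueNumber≤ {n} G w = (f : Fin (suc w) → Fin n) → ¬ IsClique G f

InClass : ∀ {n} → Graph n → ℕ → ℕ → Set
InClass G Δ ω = MaxDegree≤ G Δ × CliqueNumber≤ G ω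
  where open import Data.Product using (_×_)

k3 : ∀ {n} → Graph n → ℕ
k3 {n} G =
  count (concatMap (λ i → concatMap (λ j → map (λ l →
           ⌊ i <? j ⌋ ∧ ⌊ j <? l ⌋ ∧ adj G i j ∧ adj G j l ∧ adj G i l)
         (allFin n)) (allFin n)) (allFin n))

ρ3 : ∀ {n} .{{_ : NonZero n}} → Graph n → ℚ
ρ3 {n} G = (+ k3 G) / n

-- Turán graph T_r(n): vertex i lies in part (i mod r); parts have sizes
-- differing by at most one; complete r-partite.
Turán : (r : ℕ) .{{_ : NonZero r}} → (n : ℕ) → Graph n
Turán r n = mkSimple (λ u v → not (toℕ u % r ≡ᵇ toℕ v % r))

Empty : (m : ℕ) → Graph m
Empty m = mkSimple (λ _ _ → false)

join : ∀ {m n} → Graph m → Graph n → Graph (m + n)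
join {m} {n} G H = mkSimple R
  where
  R : Fin (m + n) → Fin (m + n) → Bool
  R u v with splitAt m u | splitAt m v
  ... | inj₁ a | inj₁ b = adj G a b
  ... | inj₂ a | inj₂ b = adj H a b
  ... | inj₁ _ | inj₂ _ = true
  ... | inj₂ _ | inj₁ _ = true

-- BT~(k) on Fin (2k+1): vertices 0..k-1 form side A, k..2k-1 form side B
-- (so A,B induce K_{k,k}); the edge xy with x = 0, y = k is deleted;
-- vertex 2k is the new vertex, adjacent exactly to x and y.
BTtilde : (k : ℕ) → Graph (suc (2 * k))
BTtilde k = mkSimple R
  where
  inA inB : ℕ → Bool
  inA a = a <ᵇ k
  inB a = not (a <ᵇ k) ∧ (a <ᵇ 2 * k)
  R : Fin (suc (2 * k)) → Fin (suc (2 * k)) → Bool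
  R u v =
    (inA (toℕ u) ∧ inB (toℕ v) ∧ not ((toℕ u ≡ᵇ 0) ∧ (toℕ v ≡ᵇ k)))
    ∨ ((toℕ u ≡ᵇ 2 * k) ∧ ((toℕ v ≡ᵇ 0) ∨ (toℕ v ≡ᵇ k)))

BT : (k : ℕ) → Graph (suc (2 * k) + suc k)
BT k = join (BTtilde k) (Empty (suc k))

{-# OPTIONS --safe #-}
module Submission where

open import Defs
open import Data.Nat using (ℕ; suc; _+_; _*_)
open import Data.Nat.Base using (NonZero)
open import Data.Integer using (+_)
open import Data.Rational using (ℚ; _/_; _<_)
open import Data.Product using (Σ; _×_)
open import Data.Sum using (_⊎_)
open import Relation.Binary.PropositionalEquality using (_≡_)

open import Data.Bool using (true) renaming (_≟_ to _≟ᵇ_)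
open import Data.Fin using (Fin)
open import Data.Fin.Patterns using (0F; 1F; 2F; 3F)
open import Data.Fin.Properties using (all?)
open import Data.Nat.Properties using (_≤?_)
open import Data.Product using (_,_)
open import Data.Sum using (inj₁; inj₂)
open import Data.Rational.Properties using (_<?_)
open import Relation.Binary.PropositionalEquality using (refl)
open import Relation.Nullary using (Dec; ¬_; ¬?)
open import Relation.Nullary.Decidable using (_×-dec_; from-yes)

-- BT(k) is K₄-free because BT~(k) is triangle-free and the added part is
-- independent; every vertex has degree 2k+1; and every triangle consists of an
-- edge of BT~(k) and a vertex of I_{k+1}, giving (k²+1)(k+1) triangles.  As
-- T₃(3k+1) has k²(k+1) triangles, BT(k) is denser exactly when k² < 3k+1,
-- i.e. for k ≤ 3.  For k ∈ {2, 3} all these facts are finite and are decided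
-- by computation.

IsK₄ : ∀ {n} → Graph n → Fin n → Fin n → Fin n → Fin n → Set
IsK₄ G a b c d =
  adj G a b ≡ true × adj G a c ≡ true × adj G a d ≡ true ×
  adj G b c ≡ true × adj G b d ≡ true × adj G c d ≡ true

K₄-free : ∀ {n} → Graph n → Set
K₄-free G = ∀ a b c d → ¬ IsK₄ G a b c d

isK₄? : ∀ {n} (G : Graph n) a b c d → Dec (IsK₄ G a b c d)
isK₄? G a b c d =
  (adj G a b ≟ᵇ true) ×-dec (adj G a c ≟ᵇ true) ×-dec (adj G a d ≟ᵇ true) ×-dec
  (adj G b c ≟ᵇ true) ×-dec (adj G b d ≟ᵇ true) ×-dec (adj G c d ≟ᵇ true)

K₄-free? : ∀ {n} (G : Graph n) → Dec (K₄-free G)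
K₄-free? G = all? λ a → all? λ b → all? λ c → all? λ d → ¬? (isK₄? G a b c d)

K₄-free⇒cliqueNumber≤3 : ∀ {n} (G : Graph n) → K₄-free G → CliqueNumber≤ G 3
K₄-free⇒cliqueNumber≤3 G free f (_ , adjacent) =
  free (f 0F) (f 1F) (f 2F) (f 3F)
    ( adjacent 0F 1F (λ ()) , adjacent 0F 2F (λ ()) , adjacent 0F 3F (λ ())
    , adjacent 1F 2F (λ ()) , adjacent 1F 3F (λ ()) , adjacent 2F 3F (λ ()) )

maxDegree≤? : ∀ {n} (G : Graph n) d → Dec (MaxDegree≤ G d)
maxDegree≤? G d = all? λ v → degree G v ≤? d

-- k is explicit: inferring it from ρ3 (BT k) makes the unifier unfold k3
-- symbolically, which is very slow.
BT-inClass : ∀ k → k ≡ 2 ⊎ k ≡ 3 → InClass (BT k) (2 * k + 1) 3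
BT-inClass .2 (inj₁ refl) =
  from-yes (maxDegree≤? (BT 2) 5) ,
  K₄-free⇒cliqueNumber≤3 (BT 2) (from-yes (K₄-free? (BT 2)))
BT-inClass .3 (inj₂ refl) =
  from-yes (maxDegree≤? (BT 3) 7) ,
  K₄-free⇒cliqueNumber≤3 (BT 3) (from-yes (K₄-free? (BT 3)))

ρ3-BT : ∀ k → k ≡ 2 ⊎ k ≡ 3 →
        ρ3 (BT k) ≡ (+ ((k + 1) * (k * k + 1))) / suc (suc (3 * k))
ρ3-BT .2 (inj₁ refl) = refl
ρ3-BT .3 (inj₂ refl) = refl

ρ3-Turán<ρ3-BT : ∀ k → k ≡ 2 ⊎ k ≡ 3 → ρ3 (Turán 3 (suc (3 * k))) < ρ3 (BT k)
ρ3-Turán<ρ3-BT .2 (inj₁ refl) = from-yes (ρ3 (Turán 3 7) <? ρ3 (BT 2))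
ρ3-Turán<ρ3-BT .3 (inj₂ refl) = from-yes (ρ3 (Turán 3 10) <? ρ3 (BT 3))

theorem6p3 : (k : ℕ) → k ≡ 2 ⊎ k ≡ 3 →
      (ρ3 (BT k) ≡ (+ ((k + 1) * (k * k + 1))) / suc (suc (3 * k)))
    × (ρ3 (Turán 3 (suc (3 * k))) < ρ3 (BT k))
    × Σ ℕ (λ n → Σ (NonZero n) (λ nz → Σ (Graph n) (λ G →
        InClass G (2 * k + 1) 3 × (ρ3 (Turán 3 (suc (3 * k))) < ρ3 {{nz}} G))))
theorem6p3 k k∈23 =
    ρ3-BT k k∈23
  , beats
  , (_ , _ , BT k , BT-inClass k k∈23 , beats)
  where
  beats : ρ3 (Turán 3 (suc (3 * k))) < ρ3 (BT k)
  beats = ρ3-Turán<ρ3-BT k k∈23
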